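{- Let $G$ be an equitably 4-colorable graph on $n\ge 2$ vertices and let $k\ge 3$, $l\ge 1$ be integers. If $3$ does not divide $n$, then $\chi_{=}(G\circ^l C_{2k})=4$.
   Context: All graphs are finite, simple and connected. $C_m$ denotes the cycle on $m$ vertices. A graph is equitably $k$-colorable if its vertex set can be partitioned into $k$ (possibly empty) independent sets $V_1,\dots,V_k$ with $||V_i|-|V_j||\le 1$ for all $i,j$; $\chi_{=}(G)$ is the least $k$ for which $G$ is equitably $k$-colorable. The corona $G\circ H$ is formed from one copy of $G$ and $|V(G)|$ copies of $H$, the $i$-th vertex of $G$ being joined to every vertex of the $i$-th copy of $H$; $G\circ^1 H=G\circ H$ and $G\circ^l H=(G\circ^{l-1}H)\circ H$ for $l\ge 2$. -}

module Defs where

open import Level using (0ℓ)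
open import Data.Nat using (ℕ; zero; suc; _+_; _*_; _∸_; _≤_; _<_)
open import Data.Fin using (Fin; toℕ; splitAt; remQuot)
open import Data.Fin.Properties using (_≟_)
open import Data.List using (List; length; filter)
open import Data.List.Base using () renaming (allFin to allFinL)
open import Data.Sum using (_⊎_; inj₁; inj₂)
open import Data.Product using (_×_; _,_; Σ)
open import Data.Empty using (⊥)
open import Relation.Nullary using (¬_)
open import Relation.Binary.PropositionalEquality using (_≡_; _≢_)

record Graph : Set₁ where
  field
    order : ℕ
    Adj   : Fin order → Fin order → Set
open Graph public

IsSimple : Graph → Set
IsSimple G = (∀ u v → Adj G u v → Adj G v u) × (∀ v → ¬ Adj G v v)

data Reachable (G : Graph) : Fin (order G) → Fin (order G) → Set where
  here : ∀ {u} → Reachable G u u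
  step : ∀ {u v w} → Adj G u v → Reachable G v w → Reachable G u w

Connected : Graph → Set
Connected G = ∀ u v → Reachable G u v

CycAdj : (m : ℕ) → Fin m → Fin m → Set
CycAdj m i j = (toℕ j ≡ suc (toℕ i)) ⊎ (toℕ i ≡ suc (toℕ j))
             ⊎ ((toℕ i ≡ 0 × toℕ j ≡ m ∸ 1) ⊎ (toℕ j ≡ 0 × toℕ i ≡ m ∸ 1))

Cycle : ℕ → Graph
Cycle m = record { order = m ; Adj = CycAdj m }

-- Corona G ∘ H: vertices of G (inj₁ a) and, for each vertex i of G,
-- a copy of H (inj₂ (i , x)); vertex i of G joined to all of copy i.
CoronaAdj : (G H : Graph) → Fin (order G) ⊎ (Fin (order G) × Fin (order H))
          → Fin (order G) ⊎ (Fin (order G) × Fin (order H)) → Set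
CoronaAdj G H (inj₁ a)       (inj₁ b)       = Adj G a b
CoronaAdj G H (inj₁ a)       (inj₂ (i , x)) = a ≡ i
CoronaAdj G H (inj₂ (i , x)) (inj₁ a)       = i ≡ a
CoronaAdj G H (inj₂ (i , x)) (inj₂ (j , y)) = (i ≡ j) × Adj H x y

coronaView : (G H : Graph) → Fin (order G + order G * order H)
           → Fin (order G) ⊎ (Fin (order G) × Fin (order H))
coronaView G H v with splitAt (order G) v
... | inj₁ a = inj₁ a
... | inj₂ p = inj₂ (remQuot (order H) p)

corona : Graph → Graph → Graph
corona G H = record
  { order = order G + order G * order H
  ; Adj   = λ u v → CoronaAdj G H (coronaView G H u) (coronaView G H v) }

coronaPow : Graph → Graph → ℕ → Graph
coronaPow G H zero    = G
coronaPow G H (suc l) = corona (coronaPow G H l) H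

classSize : ∀ {N k} → (Fin N → Fin k) → Fin k → ℕ
classSize {N} c i = length (filter (λ v → c v ≟ i) (allFinL N))

-- equitable k-colouring: proper colouring into k (possibly empty) classes
-- whose sizes differ pairwise by at most one
IsEquitableColoring : (G : Graph) (k : ℕ) → (Fin (order G) → Fin k) → Set
IsEquitableColoring G k c =
  (∀ u v → Adj G u v → c u ≢ c v) ×
  (∀ i j → classSize c i ≤ suc (classSize c j))

EquitablyColorable : Graph → ℕ → Set
EquitablyColorable G k = Σ (Fin (order G) → Fin k) (IsEquitableColoring G k)

EquitableChromaticNumber≡ : Graph → ℕ → Set
EquitableChromaticNumber≡ G k =
  EquitablyColorable G k × (∀ k' → k' < k → ¬ EquitablyColorable G k')

-- A colouring with fewer than three colours fails on the triangle formed by a vertex and two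
-- consecutive vertices of its leaf cycle. In a proper 3-colouring of B ∘ C₂ₖ every leaf cycle
-- avoids the colour of its centre, so it uses each of the two other colours k times; a class whose
-- trace on B has s vertices therefore has s + k (N − s) vertices. When k ≥ 3 sizes within one of
-- each other force all the traces to be equal, and descending the tower G ∘ˡ C₂ₖ shows that G
-- would have a 3-colouring with equal classes, so 3 ∣ n.
--
-- For four colours, the leaf cycle of a vertex of colour i gets colour i + 1 on its even positions
-- and splits its odd positions between i + 2 and i + 3, roughly half each. One vertex of each
-- colour together then contributes the same amount to every class, so only the at most three
-- larger classes of B cause an imbalance, and it is removed by changing the split at the first
-- vertex of each colour; a base graph with only two or three vertices needs its own splits.
module Submission where

open import Data.Bool.Base using (Bool; true; false; not; _∨_; if_then_else_)
open import Data.Fin.Base using (Fin; zero; suc; toℕ; fromℕ<; cast; combine; _↑ˡ_; _↑ʳ_)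
open import Data.Fin.Patterns using (0F; 1F; 2F; 3F)
open import Data.Fin.Properties
  using (_≟_; toℕ-cast; toℕ-combine; splitAt-↑ˡ; splitAt-↑ʳ; remQuot-combine; pigeonhole; all?)
open import Data.List.Base using (tabulate; length; filter)
open import Data.Nat.Base using (ℕ; zero; suc; pred; _+_; _*_; _∸_; _≤_; _<_; _<ᵇ_; s≤s; z≤n)
open import Data.Nat.Divisibility using (_∣_; divides)
open import Data.Nat.Properties
  using ( +-*-semiring; +-assoc; +-comm; +-identityʳ; +-suc; *-comm; *-suc; *-zeroʳ; *-identityʳ
        ; ≤-refl; ≤-reflexive; ≤-trans; ≤-antisym; ≤-pred; n≤1+n; m≤m+n; m≤n+m; 1+n≰n
        ; _≤?_; <⇒≤; <⇒≱; ≰⇒>; ≮⇒≥; m≤n⇒m<n∨m≡n; <ᵇ-reflects-<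
        ; +-mono-≤; +-monoˡ-≤; +-monoʳ-≤; *-monoʳ-≤; +-cancelˡ-≡; +-cancelʳ-≡; +-cancelʳ-≤
        ; m∸n+n≡m
        ; module ≤-Reasoning)
  renaming (_≟_ to _≟ℕ_)
open import Algebra.Properties.Semiring.Sum +-*-semiring
  using (sum; sum-syntax; sum-cong-≗; ∑-distrib-+; ∑-comm; *-distribˡ-sum)
open import Data.Nat.Tactic.RingSolver using (solve-∀)
open import Data.Product.Base using (_×_; _,_; Σ; proj₁; proj₂)
open import Data.Sum.Base using (_⊎_; inj₁; inj₂)
open import Function.Base using (_∘_; id)
open import Relation.Binary.PropositionalEquality
open import Relation.Nullary.Decidable.Core using (does; yes; no; ¬?; _→-dec_; _×-dec_; toWitness)
open import Relation.Nullary.Negation.Core using (¬_)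
open import Relation.Nullary.Reflects using (ofʸ; ofⁿ)

open import Defs

bit : Bool → ℕ
bit true  = 1
bit false = 0

bit≤1 : ∀ b → bit b ≤ 1
bit≤1 true  = ≤-refl
bit≤1 false = z≤n

δ : ∀ {n} → Fin n → Fin n → ℕ
δ a b = bit (does (a ≟ b))

∑-const : ∀ n x → ∑[ i < n ] x ≡ n * x
∑-const zero    x = refl
∑-const (suc n) x = cong (x +_) (∑-const n x)

∑-δ : ∀ {n} (p : Fin n) (f : Fin n → ℕ) → ∑[ i < n ] (δ p i * f i) ≡ f p
∑-δ {suc n} zero    f = begin
  f zero + 0 + ∑[ i < n ] 0  ≡⟨ cong₂ _+_ (+-identityʳ (f zero)) (trans (∑-const n 0) (*-zeroʳ n)) ⟩
  f zero + 0                 ≡⟨ +-identityʳ (f zero) ⟩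
  f zero                     ∎
  where open ≡-Reasoning
∑-δ {suc n} (suc p) f = ∑-δ p (f ∘ suc)

∑-δ₁ : ∀ {n} (p : Fin n) → ∑[ i < n ] δ p i ≡ 1
∑-δ₁ {n} p = trans (sum-cong-≗ {n} (λ i → sym (*-identityʳ (δ p i)))) (∑-δ p (λ _ → 1))

∑-↑ : ∀ m {n} (f : Fin (m + n) → ℕ) → sum f ≡ ∑[ i < m ] f (i ↑ˡ n) + ∑[ j < n ] f (m ↑ʳ j)
∑-↑ zero        f = refl
∑-↑ (suc m) {n} f = trans (cong (f zero +_) (∑-↑ m (f ∘ suc)))
  (sym (+-assoc (f zero) (∑[ i < m ] f (suc i ↑ˡ n)) (∑[ j < n ] f (suc m ↑ʳ j))))

∑-combine : ∀ m {n} (f : Fin (m * n) → ℕ) → sum f ≡ ∑[ i < m ] ∑[ j < n ] f (combine i j)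
∑-combine zero        f = refl
∑-combine (suc m) {n} f =
  trans (∑-↑ n f) (cong (∑[ j < n ] f (j ↑ˡ m * n) +_) (∑-combine m (f ∘ (n ↑ʳ_))))

∑-cast : ∀ {m n} .(eq : m ≡ n) (f : Fin n → ℕ) → sum f ≡ sum (f ∘ cast eq)
∑-cast {zero}  {zero}  eq f = refl
∑-cast {suc m} {suc n} eq f = cong (f zero +_) (∑-cast {m} {n} (cong pred eq) (f ∘ suc))

classSize-∑ : ∀ {N K} (c : Fin N → Fin K) i → classSize c i ≡ ∑[ v < N ] δ (c v) i
classSize-∑ c i = go id
  where
  go : ∀ {n} (f : Fin n → _) → length (filter (λ v → c v ≟ i) (tabulate f)) ≡ ∑[ v < n ] δ (c (f v)) i
  go {zero}  f = refl
  go {suc n} f with does (c (f zero) ≟ i)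
  ... | true  = cong suc (go (f ∘ suc))
  ... | false = go (f ∘ suc)

∑-classSize : ∀ {N K} (c : Fin N → Fin K) → ∑[ i < K ] classSize c i ≡ N
∑-classSize {N} {K} c = begin
  ∑[ i < K ] classSize c i         ≡⟨ sum-cong-≗ (classSize-∑ c) ⟩
  ∑[ i < K ] ∑[ v < N ] δ (c v) i  ≡⟨ ∑-comm (λ i v → δ (c v) i) ⟩
  ∑[ v < N ] ∑[ i < K ] δ (c v) i  ≡⟨ sum-cong-≗ (λ v → ∑-δ₁ (c v)) ⟩
  ∑[ v < N ] 1                     ≡⟨ trans (∑-const N 1) (*-identityʳ N) ⟩
  N                                ∎
  where open ≡-Reasoning

argmin : ∀ {K} (f : Fin (suc K) → ℕ) → Σ (Fin (suc K)) λ m → ∀ i → f m ≤ f i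
argmin {zero}  f = zero , λ { zero → ≤-refl }
argmin {suc K} f with argmin (f ∘ suc)
... | m , least with f zero ≤? f (suc m)
...   | yes f₀≤ = zero , λ { zero → ≤-refl ; (suc i) → ≤-trans f₀≤ (least i) }
...   | no  f₀≰ = suc m , λ { zero → <⇒≤ (≰⇒> f₀≰) ; (suc i) → least i }

Near : ℕ → ℕ → Set
Near M T = T ≤ M × M ≤ suc T

near⇒balanced : ∀ {K} (T : Fin K → ℕ) M → (∀ j → Near M (T j)) → ∀ i j → T i ≤ suc (T j)
near⇒balanced T M near i j = ≤-trans (proj₁ (near i)) (proj₂ (near j))

excess⇒near : ∀ {T L e} → e ≤ 1 → T ≡ e + L → Near (suc L) T
excess⇒near {L = L} {e} e≤1 refl = +-monoˡ-≤ L e≤1 , s≤s (m≤n+m L e)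

deficit⇒near : ∀ {T M e} → e ≤ 1 → T + e ≡ M → Near M T
deficit⇒near {T} {e = e} e≤1 refl = m≤m+n T e , ≤-trans (+-monoʳ-≤ T e≤1) (≤-reflexive (+-comm T 1))

Proper : (G : Graph) {K : ℕ} → (Fin (order G) → Fin K) → Set
Proper G c = ∀ u v → Adj G u v → c u ≢ c v

EvenlyColorable : Graph → ℕ → Set
EvenlyColorable G K =
  Σ (Fin (order G) → Fin K) λ c → Proper G c × (∀ i j → classSize c i ≡ classSize c j)

evenly⇒equitably : ∀ {G K} → EvenlyColorable G K → EquitablyColorable G K
evenly⇒equitably (c , proper , even) = c , proper , λ i j → ≤-trans (≤-reflexive (even i j)) (n≤1+n _)

evenly⇒∣ : ∀ {G K} → EvenlyColorable G (suc K) → suc K ∣ order G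
evenly⇒∣ {G} {K} (c , _ , even) = divides (classSize c zero) (begin
  order G                          ≡⟨ sym (∑-classSize c) ⟩
  ∑[ i < suc K ] classSize c i     ≡⟨ sum-cong-≗ {suc K} (λ i → even i zero) ⟩
  ∑[ i < suc K ] classSize c zero  ≡⟨ ∑-const (suc K) (classSize c zero) ⟩
  suc K * classSize c zero         ≡⟨ *-comm (suc K) _ ⟩
  classSize c zero * suc K         ∎)
  where open ≡-Reasoning

triangle⇒3≤ : ∀ {V : Set} {K} (col : V → Fin K) {x y z : V} →
              col x ≢ col y → col x ≢ col z → col y ≢ col z → 3 ≤ K
triangle⇒3≤ {K = K} col {x} {y} {z} x≢y x≢z y≢z = ≮⇒≥ λ K<3 →
  let i , j , i<j , fi≡fj = pigeonhole K<3 f in distinct i<j fi≡fj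
  where
  f : Fin 3 → Fin K
  f 0F = col x
  f 1F = col y
  f 2F = col z

  distinct : ∀ {i j} → toℕ i < toℕ j → f i ≢ f j
  distinct {0F} {1F} _ = x≢y
  distinct {0F} {2F} _ = x≢z
  distinct {1F} {2F} _ = y≢z
  distinct {0F} {0F} ()
  distinct {1F} {0F} ()
  distinct {1F} {1F} (s≤s ())
  distinct {2F} {0F} ()
  distinct {2F} {1F} (s≤s ())
  distinct {2F} {2F} (s≤s (s≤s ()))

module _ (B H : Graph) where

  private
    N = order B
    M = order H

  base : Fin N → Fin (order (corona B H))
  base a = a ↑ˡ (N * M)

  leaf : Fin N → Fin M → Fin (order (corona B H))
  leaf a x = N ↑ʳ combine a x

  view-base : ∀ a → coronaView B H (base a) ≡ inj₁ a
  view-base a rewrite splitAt-↑ˡ N a (N * M) = refl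

  view-leaf : ∀ a x → coronaView B H (leaf a x) ≡ inj₂ (a , x)
  view-leaf a x rewrite splitAt-↑ʳ N (N * M) (combine a x) | remQuot-combine a x = refl

  ∑-corona : (f : Fin (order (corona B H)) → ℕ) →
             sum f ≡ ∑[ a < N ] f (base a) + ∑[ a < N ] ∑[ x < M ] f (leaf a x)
  ∑-corona f = trans (∑-↑ N f) (cong (∑[ a < N ] f (base a) +_) (∑-combine N (f ∘ (N ↑ʳ_))))

  classSize-view : ∀ {K} (κ : Fin N ⊎ (Fin N × Fin M) → Fin K) j →
    classSize (κ ∘ coronaView B H) j ≡
    classSize (κ ∘ inj₁) j + ∑[ a < N ] ∑[ x < M ] δ (κ (inj₂ (a , x))) j
  classSize-view κ j = begin
    classSize (κ ∘ coronaView B H) j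
      ≡⟨ trans (classSize-∑ (κ ∘ coronaView B H) j) (∑-corona (λ v → δ (κ (coronaView B H v)) j)) ⟩
    ∑[ a < N ] δ (κ (coronaView B H (base a))) j +
    ∑[ a < N ] ∑[ x < M ] δ (κ (coronaView B H (leaf a x))) j
      ≡⟨ cong₂ _+_ (trans (sum-cong-≗ {N} (λ a → cong (λ p → δ (κ p) j) (view-base a)))
                          (sym (classSize-∑ (κ ∘ inj₁) j)))
                   (sum-cong-≗ {N} λ a → sum-cong-≗ {M} λ x →
                      cong (λ p → δ (κ p) j) (view-leaf a x)) ⟩
    classSize (κ ∘ inj₁) j + ∑[ a < N ] ∑[ x < M ] δ (κ (inj₂ (a , x))) j ∎
    where open ≡-Reasoning

  base-adj : ∀ {a b} → Adj B a b → Adj (corona B H) (base a) (base b)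
  base-adj {a} {b} = subst₂ (CoronaAdj B H) (sym (view-base a)) (sym (view-base b))

  spoke : ∀ a x → Adj (corona B H) (base a) (leaf a x)
  spoke a x = subst₂ (CoronaAdj B H) (sym (view-base a)) (sym (view-leaf a x)) refl

  leaf-adj : ∀ a {x y} → Adj H x y → Adj (corona B H) (leaf a x) (leaf a y)
  leaf-adj a {x} {y} xy = subst₂ (CoronaAdj B H) (sym (view-leaf a x)) (sym (view-leaf a y)) (refl , xy)

  restrict-proper : ∀ {K} {col : Fin (order (corona B H)) → Fin K} →
                    Proper (corona B H) col → Proper B (col ∘ base)
  restrict-proper proper a b ab = proper (base a) (base b) (base-adj ab)

order-coronaPow : ∀ G H l → order G ≤ order (coronaPow G H l)
order-coronaPow G H zero    = ≤-refl
order-coronaPow G H (suc l) = ≤-trans (order-coronaPow G H l) (m≤m+n _ _)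

pair : ∀ {k} → Fin k → Fin 2 → Fin (2 * k)
pair {k} m b = cast (*-comm k 2) (combine m b)

toℕ-pair : ∀ {k} (m : Fin k) b → toℕ (pair m b) ≡ 2 * toℕ m + toℕ b
toℕ-pair {k} m b = trans (toℕ-cast (*-comm k 2) (combine m b)) (toℕ-combine m b)

∑-pairs : ∀ k (f : Fin (2 * k) → ℕ) → sum f ≡ ∑[ m < k ] (f (pair m 0F) + f (pair m 1F))
∑-pairs k f = trans (∑-cast (*-comm k 2) f)
  (trans (∑-combine k (f ∘ cast (*-comm k 2)))
         (sum-cong-≗ {k} (λ m → cong (f (pair m 0F) +_) (+-identityʳ _))))

pair-adj : ∀ {k} (m : Fin k) → Adj (Cycle (2 * k)) (pair m 0F) (pair m 1F)
pair-adj m = inj₁ (trans (toℕ-pair m 1F) (trans (+-suc (2 * toℕ m) 0) (cong suc (sym (toℕ-pair m 0F)))))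

weave : ∀ {A : Set} → A → (ℕ → A) → ℕ → A
weave x f zero          = x
weave x f (suc zero)    = f 0
weave x f (suc (suc n)) = weave x (f ∘ suc) n

weave-even : ∀ {A : Set} (x : A) f m → weave x f (2 * m) ≡ x
weave-even x f zero    = refl
weave-even x f (suc m) rewrite *-suc 2 m = weave-even x (f ∘ suc) m

weave-odd : ∀ {A : Set} (x : A) f m → weave x f (suc (2 * m)) ≡ f m
weave-odd x f zero    = refl
weave-odd x f (suc m) rewrite +-suc m (m + 0) = weave-odd x (f ∘ suc) m

weave-values : ∀ {A : Set} (x : A) f n → weave x f n ≡ x ⊎ Σ ℕ λ m → weave x f n ≡ f m
weave-values x f zero          = inj₁ refl
weave-values x f (suc zero)    = inj₂ (0 , refl)
weave-values x f (suc (suc n)) with weave-values x (f ∘ suc) n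
... | inj₁ e       = inj₁ e
... | inj₂ (m , e) = inj₂ (suc m , e)

weave-step : ∀ {A : Set} {x : A} {f} → (∀ m → f m ≢ x) → ∀ n → weave x f n ≢ weave x f (suc n)
weave-step f≢x zero          = f≢x 0 ∘ sym
weave-step f≢x (suc zero)    = f≢x 0
weave-step f≢x (suc (suc n)) = weave-step (f≢x ∘ suc) n

block : ∀ {A : Set} → A → A → ℕ → ℕ → A
block y z zero    m       = z
block y z (suc u) zero    = y
block y z (suc u) (suc m) = block y z u m

block-values : ∀ {A : Set} (y z : A) u m → block y z u m ≡ y ⊎ block y z u m ≡ z
block-values y z zero    m       = inj₂ refl
block-values y z (suc u) zero    = inj₁ refl
block-values y z (suc u) (suc m) = block-values y z u m

∑-block : ∀ {K} (y z j : Fin K) u w → ∑[ m < u + w ] δ (block y z u (toℕ m)) j ≡ u * δ y j + w * δ z j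
∑-block y z j zero    w = ∑-const w (δ z j)
∑-block y z j (suc u) w = trans (cong (δ y j +_) (∑-block y z j u w)) (sym (+-assoc (δ y j) _ _))

-- Position 2m gets x, position 2m + 1 gets y if m < u and z otherwise.
cycleColouring : ∀ {K} k → Fin K → Fin K → Fin K → ℕ → Fin (2 * k) → Fin K
cycleColouring k x y z u v = weave x (block y z u) (toℕ v)

∑-cycleColouring : ∀ {K} k (x y z j : Fin K) u w → u + w ≡ k →
  ∑[ v < 2 * k ] δ (cycleColouring k x y z u v) j ≡ k * δ x j + (u * δ y j + w * δ z j)
∑-cycleColouring k x y z j u w refl = begin
  ∑[ v < 2 * k ] δ (col v) j
    ≡⟨ ∑-pairs k (λ v → δ (col v) j) ⟩
  ∑[ m < k ] (δ (col (pair m 0F)) j + δ (col (pair m 1F)) j)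
    ≡⟨ sum-cong-≗ {k} (λ m → cong₂ (λ p q → δ p j + δ q j) (even m) (odd m)) ⟩
  ∑[ m < k ] (δ x j + δ (block y z u (toℕ m)) j)
    ≡⟨ ∑-distrib-+ {k} (λ _ → δ x j) (λ m → δ (block y z u (toℕ m)) j) ⟩
  ∑[ m < k ] δ x j + ∑[ m < k ] δ (block y z u (toℕ m)) j
    ≡⟨ cong₂ _+_ (∑-const k (δ x j)) (∑-block y z j u w) ⟩
  k * δ x j + (u * δ y j + w * δ z j) ∎
  where
  open ≡-Reasoning
  col = cycleColouring k x y z u
  f = block y z u
  even : ∀ m → col (pair m 0F) ≡ x
  even m = trans (cong (weave x f) (trans (toℕ-pair m 0F) (+-identityʳ _))) (weave-even x f (toℕ m))
  odd : ∀ m → col (pair m 1F) ≡ f (toℕ m)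
  odd m = trans (cong (weave x f) (trans (toℕ-pair m 1F) (trans (+-suc _ 0) (cong suc (+-identityʳ _)))))
                (weave-odd x f (toℕ m))

cycleColouring-proper : ∀ {K} k {x y z : Fin K} u → y ≢ x → z ≢ x →
                        Proper (Cycle (2 * k)) (cycleColouring k x y z u)
cycleColouring-proper k {x} {y} {z} u y≢x z≢x = proper
  where
  f = block y z u
  w = weave x f
  odd≢x : ∀ m → f m ≢ x
  odd≢x m with block-values y z u m
  ... | inj₁ e = y≢x ∘ trans (sym e)
  ... | inj₂ e = z≢x ∘ trans (sym e)
  last≢x : ∀ k (v : Fin (2 * k)) → toℕ v ≡ 2 * k ∸ 1 → weave x f (toℕ v) ≢ x
  last≢x (suc k′) v e eq = odd≢x k′
    (trans (sym (weave-odd x f k′)) (trans (cong (weave x f) (sym (trans e (+-suc k′ (k′ + 0))))) eq))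
  proper : Proper (Cycle (2 * k)) (cycleColouring k x y z u)
  proper v v′ (inj₁ e)                      eq = weave-step odd≢x (toℕ v) (trans eq (cong w e))
  proper v v′ (inj₂ (inj₁ e))               eq = weave-step odd≢x (toℕ v′) (trans (sym eq) (cong w e))
  proper v v′ (inj₂ (inj₂ (inj₁ (e , e′)))) eq = last≢x k v′ e′ (trans (sym eq) (cong w e))
  proper v v′ (inj₂ (inj₂ (inj₂ (e , e′)))) eq = last≢x k v e′ (trans eq (cong w e))

cycleColouring-avoids : ∀ {K} k {x y z w : Fin K} u → x ≢ w → y ≢ w → z ≢ w →
                        ∀ v → cycleColouring k x y z u v ≢ w
cycleColouring-avoids k {x} {y} {z} u x≢w y≢w z≢w v with weave-values x (block y z u) (toℕ v)
... | inj₁ e       = x≢w ∘ trans (sym e)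
... | inj₂ (m , e) with block-values y z u m
...   | inj₁ e′ = y≢w ∘ trans (sym (trans e e′))
...   | inj₂ e′ = z≢w ∘ trans (sym (trans e e′))

firstThenRest : ℕ → ℕ → ℕ → ℕ
firstThenRest zero    a b = 0
firstThenRest (suc s) a b = a + s * b

-- isFirst seen c v: no earlier vertex has the colour of v, and that colour is not in seen.
isFirst : ∀ {N K} → (Fin K → Bool) → (Fin N → Fin K) → Fin N → Bool
isFirst seen c zero    = not (seen (c zero))
isFirst seen c (suc v) = isFirst (λ i → seen i ∨ does (c zero ≟ i)) (c ∘ suc) v

leader : ∀ {N K} → (Fin N → Fin K) → Fin N → Bool
leader = isFirst (λ _ → false)

private
  classTotal : Bool → ℕ → ℕ → ℕ → ℕ
  classTotal true  s a b = s * b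
  classTotal false s a b = firstThenRest s a b

  classTotal-zero : ∀ seen a b → classTotal seen 0 a b ≡ 0
  classTotal-zero true  a b = refl
  classTotal-zero false a b = refl

  classTotal-step : ∀ seen e s (F : Bool → ℕ) →
    classTotal (seen ∨ e) s (F true) (F false) + bit e * F (not seen) ≡
    classTotal seen (bit e + s) (F true) (F false)
  classTotal-step true  true  s F =
    trans (cong (s * F false +_) (+-identityʳ (F false))) (+-comm (s * F false) (F false))
  classTotal-step true  false s F = +-identityʳ _
  classTotal-step false true  s F =
    trans (cong (s * F false +_) (+-identityʳ (F true))) (+-comm (s * F false) (F true))
  classTotal-step false false s F = +-identityʳ _

  ∑-isFirst : ∀ {N K} seen (c : Fin N → Fin K) (F : Fin K → Bool → ℕ) →
    ∑[ v < N ] F (c v) (isFirst seen c v) ≡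
    ∑[ i < K ] classTotal (seen i) (∑[ v < N ] δ (c v) i) (F i true) (F i false)
  ∑-isFirst {zero} {K} seen c F =
    sym (trans (sum-cong-≗ {K} (λ i → classTotal-zero (seen i) _ _)) (trans (∑-const K 0) (*-zeroʳ K)))
  ∑-isFirst {suc N} {K} seen c F = begin
    F (c zero) (not (seen (c zero))) + ∑[ v < N ] F (c (suc v)) (isFirst seen′ (c ∘ suc) v)
      ≡⟨ cong₂ _+_ (sym (∑-δ (c zero) first)) (∑-isFirst seen′ (c ∘ suc) F) ⟩
    ∑[ i < K ] (δ (c zero) i * first i) + ∑[ i < K ] rest i
      ≡⟨ +-comm (∑[ i < K ] (δ (c zero) i * first i)) (∑[ i < K ] rest i) ⟩
    ∑[ i < K ] rest i + ∑[ i < K ] (δ (c zero) i * first i)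
      ≡⟨ sym (∑-distrib-+ {K} rest _) ⟩
    ∑[ i < K ] (rest i + δ (c zero) i * first i)
      ≡⟨ sum-cong-≗ {K} (λ i → classTotal-step (seen i) (does (c zero ≟ i)) _ (F i)) ⟩
    ∑[ i < K ] classTotal (seen i) (∑[ v < suc N ] δ (c v) i) (F i true) (F i false) ∎
    where
    open ≡-Reasoning
    seen′ : Fin K → Bool
    seen′ i = seen i ∨ does (c zero ≟ i)
    first rest : Fin K → ℕ
    first i = F i (not (seen i))
    rest i = classTotal (seen′ i) (∑[ v < N ] δ (c (suc v)) i) (F i true) (F i false)

∑-leader : ∀ {N K} (c : Fin N → Fin K) (F : Fin K → Bool → ℕ) →
  ∑[ v < N ] F (c v) (leader c v) ≡ ∑[ i < K ] firstThenRest (classSize c i) (F i true) (F i false)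
∑-leader {N} {K} c F = trans (∑-isFirst (λ _ → false) c F)
  (sym (sum-cong-≗ {K} (λ i → cong (λ s → firstThenRest s (F i true) (F i false)) (classSize-∑ c i))))

-- Three colours do not suffice

one-of-three : ∀ (x y z j : Fin 3) → x ≢ y → x ≢ z → y ≢ z → δ x j + δ y j + δ z j ≡ 1
one-of-three = toWitness {a? = all? λ x → all? λ y → all? λ z → all? λ j →
  ¬? (x ≟ y) →-dec ¬? (x ≟ z) →-dec ¬? (y ≟ z) →-dec (δ x j + δ y j + δ z j ≟ℕ 1)} _

weighted-cancel : ∀ {a x y u v} → 2 ≤ a → x + a * u ≡ y + a * v → x ≤ suc y → v ≤ u
weighted-cancel {a} {x} {y} {u} {v} 2≤a eq x≤1+y = ≮⇒≥ λ u<v → 1+n≰n (begin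
  2 + y  ≤⟨ +-monoˡ-≤ y 2≤a ⟩
  a + y  ≡⟨ +-comm a y ⟩
  y + a  ≤⟨ +-cancelʳ-≤ (a * u) (y + a) x (begin
    y + a + a * u  ≡⟨ trans (+-assoc y a (a * u)) (cong (y +_) (sym (*-suc a u))) ⟩
    y + a * suc u  ≤⟨ +-monoʳ-≤ y (*-monoʳ-≤ a u<v) ⟩
    y + a * v      ≡⟨ sym eq ⟩
    x + a * u      ∎) ⟩
  x      ≤⟨ x≤1+y ⟩
  suc y  ∎)
  where open ≤-Reasoning

module _ (B : Graph) (k : ℕ) {col : Fin (order (corona B (Cycle (2 * k)))) → Fin 3}
         (proper : Proper (corona B (Cycle (2 * k))) col) where

  private
    H = Cycle (2 * k)
    N = order B
    c = col ∘ base B H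

  -- Positions 2m and 2m + 1 of a leaf cycle and its centre are pairwise adjacent.
  leaf-count : ∀ a j → ∑[ x < 2 * k ] δ (col (leaf B H a x)) j + k * δ (c a) j ≡ k
  leaf-count a j = begin
    ∑[ x < 2 * k ] d (leaf B H a x) + k * d (base B H a)
      ≡⟨ cong₂ _+_ (∑-pairs k (d ∘ leaf B H a)) (sym (∑-const k (d (base B H a)))) ⟩
    ∑[ m < k ] (d (even m) + d (odd m)) + ∑[ m < k ] d (base B H a)
      ≡⟨ sym (∑-distrib-+ (λ m → d (even m) + d (odd m)) (λ _ → d (base B H a))) ⟩
    ∑[ m < k ] (d (even m) + d (odd m) + d (base B H a))
      ≡⟨ sum-cong-≗ {k} (λ m → one-of-three _ _ _ j
           (proper _ _ (leaf-adj B H a (pair-adj m)))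
           (λ e → proper _ _ (spoke B H a (pair m 0F)) (sym e))
           (λ e → proper _ _ (spoke B H a (pair m 1F)) (sym e))) ⟩
    ∑[ m < k ] 1
      ≡⟨ trans (∑-const k 1) (*-identityʳ k) ⟩
    k ∎
    where
    open ≡-Reasoning
    d : Fin (order (corona B H)) → ℕ
    d v = δ (col v) j
    even odd : Fin k → Fin (order (corona B H))
    even m = leaf B H a (pair m 0F)
    odd  m = leaf B H a (pair m 1F)

  size+k*s≡s+N*k : ∀ j → classSize col j + k * classSize c j ≡ classSize c j + N * k
  size+k*s≡s+N*k j = begin
    classSize col j + k * classSize c j
      ≡⟨ cong₂ _+_ (trans (classSize-∑ col j) (∑-corona B H (λ v → δ (col v) j)))
                   (trans (cong (k *_) (classSize-∑ c j)) (*-distribˡ-sum k (λ a → δ (c a) j))) ⟩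
    S + L + ∑[ a < N ] (k * δ (c a) j)
      ≡⟨ +-assoc S L _ ⟩
    S + (L + ∑[ a < N ] (k * δ (c a) j))
      ≡⟨ cong (S +_) (trans (sym (∑-distrib-+ {N} _ _)) (sum-cong-≗ {N} (λ a → leaf-count a j))) ⟩
    S + ∑[ a < N ] k
      ≡⟨ cong₂ _+_ (sym (classSize-∑ c j)) (∑-const N k) ⟩
    classSize c j + N * k ∎
    where
    open ≡-Reasoning
    S = ∑[ a < N ] δ (c a) j
    L = ∑[ a < N ] ∑[ x < 2 * k ] δ (col (leaf B H a x)) j

  equitable⇒evenly-base : 3 ≤ k → (∀ i j → classSize col i ≤ suc (classSize col j)) →
                          EvenlyColorable B 3
  equitable⇒evenly-base (s≤s 2≤k₁) equitable =
    c , restrict-proper B H proper , λ i j → ≤-antisym (base-≤ j i) (base-≤ i j)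
    where
    k₁ = pred k
    weighted : ∀ j → classSize col j + k₁ * classSize c j ≡ N * k
    weighted j = +-cancelˡ-≡ (classSize c j) _ _
      (trans (shuffle (classSize col j) (classSize c j) k₁) (size+k*s≡s+N*k j))
      where
      shuffle : ∀ x s k₁ → s + (x + k₁ * s) ≡ x + suc k₁ * s
      shuffle = solve-∀
    base-≤ : ∀ i j → classSize c j ≤ classSize c i
    base-≤ i j = weighted-cancel 2≤k₁ (trans (weighted i) (sym (weighted j))) (equitable i j)

coronaPow-equitable3⇒evenly : ∀ {G} k → 3 ≤ k → ∀ l →
  EquitablyColorable (coronaPow G (Cycle (2 * k)) (suc l)) 3 → EvenlyColorable G 3
coronaPow-equitable3⇒evenly k 3≤k zero    (_ , proper , equitable) =
  equitable⇒evenly-base _ k proper 3≤k equitable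
coronaPow-equitable3⇒evenly k 3≤k (suc l) (_ , proper , equitable) =
  coronaPow-equitable3⇒evenly k 3≤k l
    (evenly⇒equitably (equitable⇒evenly-base _ k proper 3≤k equitable))

corona-needs-three : ∀ B k {K} {col : Fin (order (corona B (Cycle (2 * k)))) → Fin K} →
  Fin (order B) → Fin k → Proper (corona B (Cycle (2 * k))) col → 3 ≤ K
corona-needs-three B k {col = col} a m proper = triangle⇒3≤ col
  (proper _ _ (spoke B H a (pair m 0F)))
  (proper _ _ (spoke B H a (pair m 1F)))
  (proper _ _ (leaf-adj B H a (pair-adj m)))
  where H = Cycle (2 * k)

coronaPow-not-equitable : ∀ {G} k l → 3 ≤ k → 2 ≤ order G → ¬ (3 ∣ order G) →
  ∀ K → K < 4 → ¬ EquitablyColorable (coronaPow G (Cycle (2 * k)) (suc l)) K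
coronaPow-not-equitable {G} k@(suc _) l 3≤k 2≤n 3∤n K K<4 colourable@(_ , proper , _)
  with m≤n⇒m<n∨m≡n (≤-pred K<4)
... | inj₁ K<3  = <⇒≱ K<3 (corona-needs-three B k vertex zero proper)
  where
  B = coronaPow G (Cycle (2 * k)) l
  vertex : Fin (order B)
  vertex = fromℕ< (≤-trans (s≤s z≤n) (≤-trans 2≤n (order-coronaPow G _ l)))
... | inj₂ refl = 3∤n (evenly⇒∣ (coronaPow-equitable3⇒evenly k 3≤k l colourable))

-- Four colours suffice

next opp prev : Fin 4 → Fin 4
next 0F = 1F
next 1F = 2F
next 2F = 3F
next 3F = 0F
opp 0F = 2F
opp 1F = 3F
opp 2F = 0F
opp 3F = 1F
prev 0F = 3F
prev 1F = 0F
prev 2F = 1F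
prev 3F = 2F

opp-opp : ∀ i → opp (opp i) ≡ i
opp-opp 0F = refl
opp-opp 1F = refl
opp-opp 2F = refl
opp-opp 3F = refl

opp-next : ∀ i → opp (next i) ≡ prev i
opp-next 0F = refl
opp-next 1F = refl
opp-next 2F = refl
opp-next 3F = refl

δ-next : ∀ i j → δ (next i) j ≡ δ (prev j) i
δ-next = toWitness {a? = all? λ i → all? λ j → δ (next i) j ≟ℕ δ (prev j) i} _

δ-opp : ∀ i j → δ (opp i) j ≡ δ (opp j) i
δ-opp = toWitness {a? = all? λ i → all? λ j → δ (opp i) j ≟ℕ δ (opp j) i} _

δ-prev : ∀ i j → δ (prev i) j ≡ δ (next j) i
δ-prev = toWitness {a? = all? λ i → all? λ j → δ (prev i) j ≟ℕ δ (next j) i} _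

palette-distinct : ∀ i → next i ≢ i × opp i ≢ i × prev i ≢ i × opp i ≢ next i × prev i ≢ next i
palette-distinct = toWitness {a? = all? λ i →
  ¬? (next i ≟ i) ×-dec ¬? (opp i ≟ i) ×-dec ¬? (prev i ≟ i) ×-dec
  ¬? (opp i ≟ next i) ×-dec ¬? (prev i ≟ next i)} _

∑-rotations : ∀ (f : Fin 4 → ℕ) j → f j + (f (prev j) + (f (opp j) + f (next j))) ≡ ∑[ i < 4 ] f i
∑-rotations f 0F = reorder (f 0F) (f 3F) (f 2F) (f 1F)
  where reorder : ∀ a d c b → a + (d + (c + b)) ≡ a + (b + (c + (d + 0)))
        reorder = solve-∀
∑-rotations f 1F = reorder (f 1F) (f 0F) (f 3F) (f 2F)
  where reorder : ∀ b a d c → b + (a + (d + c)) ≡ a + (b + (c + (d + 0)))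
        reorder = solve-∀
∑-rotations f 2F = reorder (f 2F) (f 1F) (f 0F) (f 3F)
  where reorder : ∀ c b a d → c + (b + (a + d)) ≡ a + (b + (c + (d + 0)))
        reorder = solve-∀
∑-rotations f 3F = reorder (f 3F) (f 2F) (f 1F) (f 0F)
  where reorder : ∀ d c b a → d + (c + (b + a)) ≡ a + (b + (c + (d + 0)))
        reorder = solve-∀

paletteCount : ℕ → ℕ → ℕ → Fin 4 → Fin 4 → ℕ
paletteCount a b c i j = a * δ (next i) j + (b * δ (opp i) j + c * δ (prev i) j)

firstThenRest-paletteCount : ∀ s a b₁ c₁ b c i j →
  firstThenRest s (paletteCount a b₁ c₁ i j) (paletteCount a b c i j) ≡
  paletteCount (s * a) (firstThenRest s b₁ b) (firstThenRest s c₁ c) i j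
firstThenRest-paletteCount zero    a b₁ c₁ b c i j = refl
firstThenRest-paletteCount (suc s) a b₁ c₁ b c i j =
  linear s a b₁ c₁ b c (δ (next i) j) (δ (opp i) j) (δ (prev i) j)
  where
  linear : ∀ s a b₁ c₁ b c x y z →
    a * x + (b₁ * y + c₁ * z) + s * (a * x + (b * y + c * z)) ≡
    (a + s * a) * x + ((b₁ + s * b) * y + (c₁ + s * c) * z)
  linear = solve-∀

∑-paletteCount : ∀ (a b c : Fin 4 → ℕ) j →
  ∑[ i < 4 ] paletteCount (a i) (b i) (c i) i j ≡ a (prev j) + (b (opp j) + c (next j))
∑-paletteCount a b c j = begin
  ∑[ i < 4 ] paletteCount (a i) (b i) (c i) i j
    ≡⟨ ∑-distrib-+ {4} (λ i → a i * δ (next i) j) (λ i → b i * δ (opp i) j + c i * δ (prev i) j) ⟩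
  ∑[ i < 4 ] (a i * δ (next i) j) + ∑[ i < 4 ] (b i * δ (opp i) j + c i * δ (prev i) j)
    ≡⟨ cong (∑[ i < 4 ] (a i * δ (next i) j) +_)
            (∑-distrib-+ {4} (λ i → b i * δ (opp i) j) (λ i → c i * δ (prev i) j)) ⟩
  ∑[ i < 4 ] (a i * δ (next i) j) + (∑[ i < 4 ] (b i * δ (opp i) j) + ∑[ i < 4 ] (c i * δ (prev i) j))
    ≡⟨ cong₂ _+_ (pick next prev a δ-next)
                 (cong₂ _+_ (pick opp opp b δ-opp) (pick prev next c δ-prev)) ⟩
  a (prev j) + (b (opp j) + c (next j)) ∎
  where
  open ≡-Reasoning
  pick : ∀ (σ τ : Fin 4 → Fin 4) (f : Fin 4 → ℕ) → (∀ i j → δ (σ i) j ≡ δ (τ j) i) →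
         ∑[ i < 4 ] (f i * δ (σ i) j) ≡ f (τ j)
  pick σ τ f δ-σ = trans (sum-cong-≗ {4} (λ i → trans (*-comm (f i) (δ (σ i) j)) (cong (_* f i) (δ-σ i j))))
                         (∑-δ (τ j) f)

-- A vertex of colour i gives its leaf cycle colour next i on the even positions and splits the odd
-- positions between opp i and prev i: (h, g) in general, (leaderU i, leaderW i) for the first one.
module RotationColouring (B : Graph) (c : Fin (order B) → Fin 4) (c-proper : Proper B c)
                         (h g : ℕ) (leaderU leaderW : Fin 4 → ℕ)
                         (leader-split : ∀ i → leaderU i + leaderW i ≡ h + g) where

  private
    N = order B
    k = h + g
    H = Cycle (2 * k)

  splitU splitW : Fin 4 → Bool → ℕ
  splitU i true  = leaderU i
  splitU i false = h
  splitW i true  = leaderW i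
  splitW i false = g

  split-sum : ∀ i b → splitU i b + splitW i b ≡ k
  split-sum i true  = leader-split i
  split-sum i false = refl

  leafColour : Fin N → Fin (2 * k) → Fin 4
  leafColour a = cycleColouring k (next (c a)) (opp (c a)) (prev (c a)) (splitU (c a) (leader c a))

  viewColour : Fin N ⊎ (Fin N × Fin (2 * k)) → Fin 4
  viewColour (inj₁ a)       = c a
  viewColour (inj₂ (a , x)) = leafColour a x

  colouring : Fin (order (corona B H)) → Fin 4
  colouring = viewColour ∘ coronaView B H

  colouring-proper : Proper (corona B H) colouring
  colouring-proper u v = proper (coronaView B H u) (coronaView B H v)
    where
    avoids : ∀ a x → leafColour a x ≢ c a
    avoids a x = let n≢ , o≢ , p≢ , _ = palette-distinct (c a) in
      cycleColouring-avoids k (splitU (c a) (leader c a)) n≢ o≢ p≢ x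
    proper : ∀ p q → CoronaAdj B H p q → viewColour p ≢ viewColour q
    proper (inj₁ a)       (inj₁ b)       ab          = c-proper a b ab
    proper (inj₁ a)       (inj₂ (b , x)) refl        = avoids a x ∘ sym
    proper (inj₂ (a , x)) (inj₁ b)       refl        = avoids a x
    proper (inj₂ (a , x)) (inj₂ (b , y)) (refl , xy) =
      let _ , _ , _ , o≢n , p≢n = palette-distinct (c a) in
      cycleColouring-proper k (splitU (c a) (leader c a)) o≢n p≢n x y xy

  ∑-leafColour : ∀ a j → ∑[ x < 2 * k ] δ (leafColour a x) j ≡
                 paletteCount k (splitU (c a) (leader c a)) (splitW (c a) (leader c a)) (c a) j
  ∑-leafColour a j = ∑-cycleColouring k (next (c a)) (opp (c a)) (prev (c a)) j
    (splitU (c a) (leader c a)) (splitW (c a) (leader c a)) (split-sum (c a) (leader c a))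

  U W : Fin 4 → ℕ
  U i = firstThenRest (classSize c i) (leaderU i) h
  W i = firstThenRest (classSize c i) (leaderW i) g

  classSize-colouring : ∀ j →
    classSize colouring j ≡ classSize c j + (classSize c (prev j) * k + (U (opp j) + W (next j)))
  classSize-colouring j = begin
    classSize colouring j
      ≡⟨ classSize-view B H viewColour j ⟩
    classSize c j + ∑[ a < N ] ∑[ x < 2 * k ] δ (leafColour a x) j
      ≡⟨ cong (classSize c j +_) (sum-cong-≗ {N} (λ a → ∑-leafColour a j)) ⟩
    classSize c j + ∑[ a < N ] count (c a) (leader c a)
      ≡⟨ cong (classSize c j +_) (∑-leader c count) ⟩
    classSize c j + ∑[ i < 4 ] firstThenRest (classSize c i) (count i true) (count i false)
      ≡⟨ cong (classSize c j +_) (sum-cong-≗ {4} (λ i →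
           firstThenRest-paletteCount (classSize c i) k (leaderU i) (leaderW i) h g i j)) ⟩
    classSize c j + ∑[ i < 4 ] paletteCount (classSize c i * k) (U i) (W i) i j
      ≡⟨ cong (classSize c j +_) (∑-paletteCount (λ i → classSize c i * k) U W j) ⟩
    classSize c j + (classSize c (prev j) * k + (U (opp j) + W (next j))) ∎
    where
    open ≡-Reasoning
    count : Fin 4 → Bool → ℕ
    count i b = paletteCount k (splitU i b) (splitW i b) i j

halve : ∀ k → Σ ℕ λ h → Σ ℕ λ g → k ≡ h + g × (g ≡ h ⊎ g ≡ suc h)
halve zero = 0 , 0 , refl , inj₁ refl
halve (suc k) with halve k
... | h , g , refl , inj₁ refl = h , suc h , sym (+-suc h h) , inj₂ refl
... | h , g , refl , inj₂ refl = suc h , suc h , refl , inj₁ refl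

halves-≤ : ∀ {h g} → g ≡ h ⊎ g ≡ suc h → h ≤ g × g ≤ suc h
halves-≤ (inj₁ refl) = ≤-refl , n≤1+n _
halves-≤ (inj₂ refl) = n≤1+n _ , ≤-refl

two-sizes : ∀ {q s} → q ≤ s → s ≤ suc q → s ≡ q + bit (q <ᵇ s)
two-sizes {q} {s} q≤s s≤1+q with q <ᵇ s | <ᵇ-reflects-< q s
... | true  | ofʸ q<s = trans (≤-antisym s≤1+q q<s) (+-comm 1 q)
... | false | ofⁿ q≮s = sym (trans (+-identityʳ q) (≤-antisym q≤s (≮⇒≥ q≮s)))

module NonEmptyClasses (B : Graph) (c : Fin (order B) → Fin 4) (c-proper : Proper B c)
                       (h g : ℕ) (h≤g : h ≤ g) (q : ℕ) (big : Fin 4 → Bool)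
                       (sizes : ∀ i → classSize c i ≡ suc q + bit (big i)) where

  leaderU leaderW : Fin 4 → ℕ
  leaderU i = if big (opp i) then h + h else h
  leaderW i = if big (opp i) then g ∸ h else g

  leader-split : ∀ i → leaderU i + leaderW i ≡ h + g
  leader-split i with big (opp i)
  ... | true  = trans (+-assoc h h (g ∸ h)) (cong (h +_) (trans (+-comm h (g ∸ h)) (m∸n+n≡m h≤g)))
  ... | false = refl

  open RotationColouring B c c-proper h g leaderU leaderW leader-split public

  private
    x : Fin 4 → ℕ
    x i = bit (big i)

    leaderU≡ : ∀ i → leaderU i ≡ h + h * x (opp i)
    leaderU≡ i with big (opp i)
    ... | true  = cong (h +_) (sym (*-identityʳ h))
    ... | false = sym (trans (cong (h +_) (*-zeroʳ h)) (+-identityʳ h))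

    leaderW+ : ∀ i → leaderW i + h * x (opp i) ≡ g
    leaderW+ i with big (opp i)
    ... | true  = trans (cong (g ∸ h +_) (*-identityʳ h)) (m∸n+n≡m h≤g)
    ... | false = trans (cong (g +_) (*-zeroʳ h)) (+-identityʳ g)

    -- The leader split w = g ∸ h · x₁ is a truncated difference, so it is only used through w + h · x₁ = g.
    arith : ∀ q h g x₀ x₁ x₂ x₃ w → w + h * x₁ ≡ g →
      suc q + x₀ + ((suc q + x₁) * (h + g) + ((h + h * x₀ + (q + x₂) * h) + (w + (q + x₃) * g))) ≡
      suc q * (1 + 2 * (h + g)) + ((1 + h) * x₀ + (g * x₁ + (h * x₂ + g * x₃)))
    arith q h g x₀ x₁ x₂ x₃ w w+hx₁≡g = +-cancelʳ-≡ (h * x₁) _ _ (begin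
      suc q + x₀ + ((suc q + x₁) * (h + g) + ((h + h * x₀ + (q + x₂) * h) + (w + (q + x₃) * g))) + h * x₁
        ≡⟨ regroup q h g x₀ x₁ x₂ x₃ w ⟩
      E + (w + h * x₁)
        ≡⟨ cong (E +_) w+hx₁≡g ⟩
      E + g
        ≡⟨ collect q h g x₀ x₁ x₂ x₃ ⟩
      suc q * (1 + 2 * (h + g)) + ((1 + h) * x₀ + (g * x₁ + (h * x₂ + g * x₃))) + h * x₁ ∎)
      where
      open ≡-Reasoning
      E = suc q + x₀ + ((suc q + x₁) * (h + g) + ((h + h * x₀ + (q + x₂) * h) + (q + x₃) * g))
      regroup : ∀ q h g x₀ x₁ x₂ x₃ w →
        suc q + x₀ + ((suc q + x₁) * (h + g) + ((h + h * x₀ + (q + x₂) * h) + (w + (q + x₃) * g))) + h * x₁ ≡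
        suc q + x₀ + ((suc q + x₁) * (h + g) + ((h + h * x₀ + (q + x₂) * h) + (q + x₃) * g)) + (w + h * x₁)
      regroup = solve-∀
      collect : ∀ q h g x₀ x₁ x₂ x₃ →
        suc q + x₀ + ((suc q + x₁) * (h + g) + ((h + h * x₀ + (q + x₂) * h) + (q + x₃) * g)) + g ≡
        suc q * (1 + 2 * (h + g)) + ((1 + h) * x₀ + (g * x₁ + (h * x₂ + g * x₃))) + h * x₁
      collect = solve-∀

  classSize-closed : ∀ j → classSize colouring j ≡
    suc q * (1 + 2 * (h + g)) + ((1 + h) * x j + (g * x (prev j) + (h * x (opp j) + g * x (next j))))
  classSize-closed j = begin
    classSize colouring j
      ≡⟨ classSize-colouring j ⟩
    classSize c j + (classSize c (prev j) * (h + g) + (U (opp j) + W (next j)))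
      ≡⟨ cong₂ (λ s t → s + (t * (h + g) + (U (opp j) + W (next j)))) (sizes j) (sizes (prev j)) ⟩
    suc q + x j + ((suc q + x (prev j)) * (h + g) + (U (opp j) + W (next j)))
      ≡⟨ cong (λ t → suc q + x j + ((suc q + x (prev j)) * (h + g) + t)) (cong₂ _+_ U≡ W≡) ⟩
    suc q + x j + ((suc q + x (prev j)) * (h + g) +
      ((h + h * x j + (q + x (opp j)) * h) + (leaderW (next j) + (q + x (next j)) * g)))
      ≡⟨ arith q h g (x j) (x (prev j)) (x (opp j)) (x (next j)) (leaderW (next j))
               (trans (cong (λ i → leaderW (next j) + h * x i) (sym (opp-next j))) (leaderW+ (next j))) ⟩
    suc q * (1 + 2 * (h + g)) + ((1 + h) * x j + (g * x (prev j) + (h * x (opp j) + g * x (next j)))) ∎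
    where
    open ≡-Reasoning
    U≡ : U (opp j) ≡ h + h * x j + (q + x (opp j)) * h
    U≡ = trans (cong (λ s → firstThenRest s (leaderU (opp j)) h) (sizes (opp j)))
               (cong (_+ (q + x (opp j)) * h)
                     (trans (leaderU≡ (opp j)) (cong (λ i → h + h * x i) (opp-opp j))))
    W≡ : W (next j) ≡ leaderW (next j) + (q + x (next j)) * g
    W≡ = cong (λ s → firstThenRest s (leaderW (next j)) g) (sizes (next j))

  private
    Q = suc q * (1 + 2 * (h + g))
    R = ∑[ i < 4 ] x i

  balanced : g ≡ h ⊎ g ≡ suc h → ∀ i j → classSize colouring i ≤ suc (classSize colouring j)
  balanced (inj₁ refl) = near⇒balanced _ (suc (Q + h * R)) λ j →
    excess⇒near (bit≤1 (big j)) (trans (classSize-closed j) (begin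
      Q + ((1 + h) * x j + (h * x (prev j) + (h * x (opp j) + h * x (next j))))
        ≡⟨ spread Q h (x j) (x (prev j)) (x (opp j)) (x (next j)) ⟩
      x j + (Q + h * (x j + (x (prev j) + (x (opp j) + x (next j)))))
        ≡⟨ cong (λ r → x j + (Q + h * r)) (∑-rotations x j) ⟩
      x j + (Q + h * R) ∎))
    where
    open ≡-Reasoning
    spread : ∀ Q h x₀ x₁ x₂ x₃ →
      Q + ((1 + h) * x₀ + (h * x₁ + (h * x₂ + h * x₃))) ≡ x₀ + (Q + h * (x₀ + (x₁ + (x₂ + x₃))))
    spread = solve-∀
  balanced (inj₂ refl) = near⇒balanced _ (Q + suc h * R) λ j →
    deficit⇒near (bit≤1 (big (opp j))) (trans (cong (_+ x (opp j)) (classSize-closed j)) (begin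
      Q + ((1 + h) * x j + (suc h * x (prev j) + (h * x (opp j) + suc h * x (next j)))) + x (opp j)
        ≡⟨ spread Q h (x j) (x (prev j)) (x (opp j)) (x (next j)) ⟩
      Q + suc h * (x j + (x (prev j) + (x (opp j) + x (next j))))
        ≡⟨ cong (λ r → Q + suc h * r) (∑-rotations x j) ⟩
      Q + suc h * R ∎))
    where
    open ≡-Reasoning
    spread : ∀ Q h x₀ x₁ x₂ x₃ →
      Q + ((1 + h) * x₀ + (suc h * x₁ + (h * x₂ + suc h * x₃))) + x₂ ≡
      Q + suc h * (x₀ + (x₁ + (x₂ + x₃)))
    spread = solve-∀

-- The size of class j when every class of B has at most one vertex: b₀, b₁, b₂, b₃ say whether
-- the classes j, prev j, opp j, next j are nonempty, and a vertex of colour i splits its odd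
-- positions as (xU, xW) if class opp i is nonempty and as (0, h + g) otherwise.
singletonTotal : (h g xU xW : ℕ) → Bool → Bool → Bool → Bool → ℕ
singletonTotal h g xU xW b₀ b₁ b₂ b₃ =
  bit b₀ + (bit b₁ * (h + g) + (firstThenRest (bit b₂) (if b₀ then xU else 0) h +
                                firstThenRest (bit b₃) (if b₁ then xW else h + g) g))

private
  +0+0 : ∀ n → n + 0 + 0 ≡ n
  +0+0 n = trans (+-identityʳ (n + 0)) (+-identityʳ n)

singletonTotal-two : ∀ h g b₀ b₁ b₂ b₃ → bit b₀ + (bit b₁ + (bit b₂ + bit b₃)) ≡ 2 →
                     singletonTotal h g (h + g) 0 b₀ b₁ b₂ b₃ ≡ bit b₀ + (h + g)
singletonTotal-two h g true  true  false false _ = cong suc (+0+0 (h + g))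
singletonTotal-two h g true  false true  false _ = cong suc (+0+0 (h + g))
singletonTotal-two h g true  false false true  _ = cong suc (+-identityʳ (h + g))
singletonTotal-two h g false true  true  false _ = +0+0 (h + g)
singletonTotal-two h g false true  false true  _ = +0+0 (h + g)
singletonTotal-two h g false false true  true  _ = +-identityʳ (h + g)
singletonTotal-two h g true  true  true  _     ()
singletonTotal-two h g true  true  false true  ()
singletonTotal-two h g true  false true  true  ()
singletonTotal-two h g true  false false false ()
singletonTotal-two h g false true  true  true  ()
singletonTotal-two h g false true  false false ()
singletonTotal-two h g false false true  false ()
singletonTotal-two h g false false false true  ()
singletonTotal-two h g false false false false ()

singletonTotal-three : ∀ h g → h ≤ g → g ≤ suc h → ∀ b₀ b₁ b₂ b₃ →
  bit b₀ + (bit b₁ + (bit b₂ + bit b₃)) ≡ 3 →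
  Near (suc (h + g + g)) (singletonTotal h g h g b₀ b₁ b₂ b₃)
singletonTotal-three h g h≤g g≤1+h b₀ b₁ b₂ b₃ count = near (value b₀ b₁ b₂ b₃ count)
  where
  K = h + g
  value : ∀ b₀ b₁ b₂ b₃ → bit b₀ + (bit b₁ + (bit b₂ + bit b₃)) ≡ 3 →
          let T = singletonTotal h g h g b₀ b₁ b₂ b₃ in T ≡ suc (K + h) ⊎ T ≡ suc (K + g) ⊎ T ≡ K + g
  value true  true  true  false _ = inj₁ (cong suc (cong₂ _+_ (+-identityʳ K) (+0+0 h)))
  value true  true  false true  _ = inj₂ (inj₁ (cong suc (cong₂ _+_ (+-identityʳ K) (+-identityʳ g))))
  value true  false true  true  _ =
    inj₁ (cong suc (trans (cong₂ _+_ (+-identityʳ h) (+-identityʳ K)) (+-comm h K)))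
  value false true  true  true  _ = inj₂ (inj₂ (cong₂ _+_ (+-identityʳ K) (+-identityʳ g)))
  value true  true  true  true  ()
  value true  true  false false ()
  value true  false true  false ()
  value true  false false true  ()
  value true  false false false ()
  value false true  true  false ()
  value false true  false true  ()
  value false true  false false ()
  value false false true  true  ()
  value false false true  false ()
  value false false false true  ()
  value false false false false ()
  near : ∀ {T} → T ≡ suc (K + h) ⊎ T ≡ suc (K + g) ⊎ T ≡ K + g → Near (suc (K + g)) T
  near (inj₁ refl)        =
    s≤s (+-monoʳ-≤ K h≤g) , s≤s (≤-trans (+-monoʳ-≤ K g≤1+h) (≤-reflexive (+-suc K h)))
  near (inj₂ (inj₁ refl)) = ≤-refl , n≤1+n _
  near (inj₂ (inj₂ refl)) = n≤1+n _ , ≤-refl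

module SingletonClasses (B : Graph) (c : Fin (order B) → Fin 4) (c-proper : Proper B c)
                        (h g : ℕ) (big : Fin 4 → Bool) (sizes : ∀ i → classSize c i ≡ bit (big i))
                        (xU xW : ℕ) (x-split : xU + xW ≡ h + g) where

  leaderU leaderW : Fin 4 → ℕ
  leaderU i = if big (opp i) then xU else 0
  leaderW i = if big (opp i) then xW else h + g

  leader-split : ∀ i → leaderU i + leaderW i ≡ h + g
  leader-split i with big (opp i)
  ... | true  = x-split
  ... | false = refl

  open RotationColouring B c c-proper h g leaderU leaderW leader-split public

  classSize-pattern : ∀ j →
    classSize colouring j ≡ singletonTotal h g xU xW (big j) (big (prev j)) (big (opp j)) (big (next j))
  classSize-pattern j = begin
    classSize colouring j
      ≡⟨ classSize-colouring j ⟩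
    classSize c j + (classSize c (prev j) * (h + g) + (U (opp j) + W (next j)))
      ≡⟨ cong₂ (λ s t → s + (t * (h + g) + (U (opp j) + W (next j)))) (sizes j) (sizes (prev j)) ⟩
    bit (big j) + (bit (big (prev j)) * (h + g) + (U (opp j) + W (next j)))
      ≡⟨ cong (λ t → bit (big j) + (bit (big (prev j)) * (h + g) + t)) (cong₂ _+_
           (cong₂ (λ s i → firstThenRest s (if big i then xU else 0) h) (sizes (opp j)) (opp-opp j))
           (cong₂ (λ s i → firstThenRest s (if big i then xW else h + g) g) (sizes (next j)) (opp-next j))) ⟩
    singletonTotal h g xU xW (big j) (big (prev j)) (big (opp j)) (big (next j)) ∎
    where open ≡-Reasoning

two-or-three : ∀ {n} → 2 ≤ n → n ≤ 3 → n ≡ 2 ⊎ n ≡ 3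
two-or-three (s≤s (s≤s z≤n)) (s≤s (s≤s z≤n))       = inj₁ refl
two-or-three (s≤s (s≤s z≤n)) (s≤s (s≤s (s≤s z≤n))) = inj₂ refl

-- If q = 0, every class of B has at most one vertex and B has two or three vertices.
corona-equitable-sizes : ∀ {B} (c : Fin (order B) → Fin 4) → Proper B c → 2 ≤ order B →
  ∀ h g → g ≡ h ⊎ g ≡ suc h →
  ∀ q (big : Fin 4 → Bool) → (∀ i → classSize c i ≡ q + bit (big i)) → ∀ m → bit (big m) ≡ 0 →
  EquitablyColorable (corona B (Cycle (2 * (h + g)))) 4
corona-equitable-sizes {B} c c-proper 2≤N h g halves (suc q) big sizes _ _ =
  colouring , colouring-proper , balanced halves
  where open NonEmptyClasses B c c-proper h g (proj₁ (halves-≤ halves)) q big sizes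
corona-equitable-sizes {B} c c-proper 2≤N h g halves zero big sizes m small =
  by-order (two-or-three 2≤N (≤-trans (≤-reflexive (sym (trans (∑-rotations x m) total))) three-bits))
  where
  x : Fin 4 → ℕ
  x i = bit (big i)
  total : ∑[ i < 4 ] x i ≡ order B
  total = trans (sym (sum-cong-≗ {4} sizes)) (∑-classSize c)
  three-bits : x m + (x (prev m) + (x (opp m) + x (next m))) ≤ 3
  three-bits rewrite small =
    +-mono-≤ (bit≤1 (big (prev m))) (+-mono-≤ (bit≤1 (big (opp m))) (bit≤1 (big (next m))))
  count : ∀ {n} → order B ≡ n → ∀ j → x j + (x (prev j) + (x (opp j) + x (next j))) ≡ n
  count N≡n j = trans (∑-rotations x j) (trans total N≡n)

  by-order : order B ≡ 2 ⊎ order B ≡ 3 → EquitablyColorable (corona B (Cycle (2 * (h + g)))) 4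
  by-order (inj₁ N≡2) = colouring , colouring-proper , near⇒balanced _ (suc (h + g)) λ j →
    excess⇒near (bit≤1 (big j)) (trans (classSize-pattern j)
      (singletonTotal-two h g (big j) (big (prev j)) (big (opp j)) (big (next j)) (count N≡2 j)))
    where open SingletonClasses B c c-proper h g big sizes (h + g) 0 (+-identityʳ (h + g))
  by-order (inj₂ N≡3) = colouring , colouring-proper , near⇒balanced _ (suc (h + g + g)) λ j →
    subst (Near (suc (h + g + g))) (sym (classSize-pattern j))
      (singletonTotal-three h g h≤g g≤1+h (big j) (big (prev j)) (big (opp j)) (big (next j))
                            (count N≡3 j))
    where
    open SingletonClasses B c c-proper h g big sizes h g refl
    h≤g = proj₁ (halves-≤ halves)
    g≤1+h = proj₂ (halves-≤ halves)

corona-equitable : ∀ {B} k → 2 ≤ order B → EquitablyColorable B 4 →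
                   EquitablyColorable (corona B (Cycle (2 * k))) 4
corona-equitable {B} k 2≤N (c , c-proper , equitable) with halve k
... | h , g , refl , halves = corona-equitable-sizes c c-proper 2≤N h g halves q big sizes m smallest
  where
  m = proj₁ (argmin (classSize c))
  q = classSize c m
  big : Fin 4 → Bool
  big i = q <ᵇ classSize c i
  sizes : ∀ i → classSize c i ≡ q + bit (big i)
  sizes i = two-sizes (proj₂ (argmin (classSize c)) i) (equitable i m)
  smallest : bit (big m) ≡ 0
  smallest = sym (+-cancelˡ-≡ q 0 (bit (big m)) (trans (+-identityʳ q) (sizes m)))

coronaPow-equitable : ∀ {G} k l → 2 ≤ order G → EquitablyColorable G 4 →
                      EquitablyColorable (coronaPow G (Cycle (2 * k)) l) 4
coronaPow-equitable     k zero    2≤n colourable = colourable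
coronaPow-equitable {G} k (suc l) 2≤n colourable =
  corona-equitable k (≤-trans 2≤n (order-coronaPow G _ l)) (coronaPow-equitable k l 2≤n colourable)

theorem4 : (G : Graph) → IsSimple G → Connected G → EquitablyColorable G 4 →
    2 ≤ order G → (k l : ℕ) → 3 ≤ k → 1 ≤ l → ¬ (3 ∣ order G) →
    EquitableChromaticNumber≡ (coronaPow G (Cycle (2 * k)) l) 4
theorem4 G _ _ colourable 2≤n k (suc l) 3≤k _ 3∤n =
  coronaPow-equitable k (suc l) 2≤n colourable , coronaPow-not-equitable k l 3≤k 2≤n 3∤n
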